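{- Let $\overrightarrow{G}=\overrightarrow{G}(V,E)$ be a 2-qBMG with color classes $U$ and $W$, and let $\Gamma$ be a subgroup of $\mathrm{Aut}_I(\overrightarrow{G})$. Then the $\Gamma$-quotient $\overrightarrow{G}/\Gamma$ is also a 2-qBMG (with color classes the set of $\Gamma$-orbits contained in $U$ and the set of $\Gamma$-orbits contained in $W$).
   Context: A digraph $\overrightarrow{G}=\overrightarrow{G}(V,E)$ has a finite vertex set $V$ and edge set $E\subseteq V\times V$ without loops; the edge with tail $u$ and head $v$ is written $uv$; both $uv$ and $vu$ may be edges (a symmetric edge). $N^+(v)=\{w: vw\in E\}$ and $N^-(v)=\{w: wv\in E\}$. Two vertices $u,v$ are independent if neither $uv$ nor $vu$ is in $E$. A 2-qBMG is a digraph, equipped with a partition $V=U\cup W$ into two color classes such that every edge joins a vertex of $U$ and a vertex of $W$, satisfying: (N1) if $u$ and $v$ are independent vertices then there are no vertices $w,t$ with $ut,vw,tw\in E$; (N2) if $uv,vw,wt\in E$ then $ut\in E$; (N3) if $u$ and $v$ have a common out-neighbor then $N^+(u)\subseteq N^+(v)$ or $N^+(v)\subseteq N^+(u)$. An automorphism of $\overrightarrow{G}$ is a permutation $\pi$ of $V$ with $xy\in E\Rightarrow \pi(x)\pi(y)\in E$; $\mathrm{Aut}_I(\overrightarrow{G})$ is the group of color-preserving automorphisms, i.e. those mapping $U$ to $U$ and $W$ to $W$. For a subgroup $\Gamma\le \mathrm{Aut}_I(\overrightarrow{G})$, the $\Gamma$-quotient $\overrightarrow{G}/\Gamma$ is the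 digraph whose vertices are the $\Gamma$-orbits on $V$ (each contained in $U$ or in $W$), with an edge from orbit $O_1$ to orbit $O_2$ if and only if there exist $x\in O_1$, $y\in O_2$ with $xy\in E$. -}

module Defs where

open import Data.Nat using (ℕ)
open import Data.Fin using (Fin)
open import Data.Fin.Permutation using (Permutation′; _⟨$⟩ʳ_; id; flip; _∘ₚ_)
open import Data.Bool using (Bool)
open import Data.Product using (Σ; ∃; ∃-syntax; _×_; _,_)
open import Data.Sum using (_⊎_)
open import Relation.Nullary using (¬_)
open import Relation.Binary.PropositionalEquality using (_≡_; _≢_)
open import Relation.Binary.Structures using (IsEquivalence)

-- A digraph on a vertex "set" presented as a type V with an equivalence
-- relation _≈_ (vertex identity); E is the edge relation, col a 2-colouring
-- (col v ≡ false : v ∈ U, col v ≡ true : v ∈ W).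

Independent : {V : Set} → (V → V → Set) → V → V → Set
Independent E u v = ¬ (E u v) × ¬ (E v u)

OutSub : {V : Set} → (V → V → Set) → V → V → Set
OutSub E u v = ∀ x → E u x → E v x

record Is2qBMG {V : Set} (_≈_ : V → V → Set) (E : V → V → Set) (col : V → Bool) : Set where
  field
    ≈-isEquivalence : IsEquivalence _≈_
    E-resp : ∀ {x x′ y y′} → x ≈ x′ → y ≈ y′ → E x y → E x′ y′
    col-resp : ∀ {x y} → x ≈ y → col x ≡ col y
    loopless : ∀ {x y} → x ≈ y → ¬ (E x y)
    bipartite : ∀ {x y} → E x y → col x ≢ col y
    N1 : ∀ u v → Independent E u v →
         ¬ (∃[ w ] ∃[ t ] (E u t × E v w × E t w))
    N2 : ∀ u v w t → E u v → E v w → E w t → E u t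
    N3 : ∀ u v → (∃[ x ] (E u x × E v x)) → OutSub E u v ⊎ OutSub E v u

Is2qBMGFin : (n : ℕ) → (Fin n → Fin n → Set) → (Fin n → Bool) → Set
Is2qBMGFin n E col = Is2qBMG {Fin n} _≡_ E col

IsAutI : {n : ℕ} → (Fin n → Fin n → Set) → (Fin n → Bool) → Permutation′ n → Set
IsAutI E col π =
  (∀ x y → E x y → E (π ⟨$⟩ʳ x) (π ⟨$⟩ʳ y)) × (∀ x → col (π ⟨$⟩ʳ x) ≡ col x)

record IsSubgroupAutI {n : ℕ} (E : Fin n → Fin n → Set) (col : Fin n → Bool)
                      (Γ : Permutation′ n → Set) : Set where
  field
    ⊆AutI : ∀ π → Γ π → IsAutI E col π
    has-id : Γ id
    ∘-closed : ∀ π ρ → Γ π → Γ ρ → Γ (π ∘ₚ ρ)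
    inv-closed : ∀ π → Γ π → Γ (flip π)

SameOrbit : {n : ℕ} → (Permutation′ n → Set) → Fin n → Fin n → Set
SameOrbit Γ x y = ∃[ π ] (Γ π × π ⟨$⟩ʳ x ≡ y)

-- Edge relation of the Γ-quotient, on representatives: orbit(x) → orbit(y)
-- iff some x′ in orbit(x), y′ in orbit(y) have x′y′ ∈ E.
QuotEdge : {n : ℕ} → (Fin n → Fin n → Set) → (Permutation′ n → Set) → Fin n → Fin n → Set
QuotEdge E Γ x y = ∃[ x′ ] ∃[ y′ ] (SameOrbit Γ x x′ × SameOrbit Γ y y′ × E x′ y′)

{-# OPTIONS --safe #-}
module Submission where

-- Γ acts by colour-preserving automorphisms, so an edge between two orbits
-- can be realised by an edge of G leaving (or entering) any prescribed
-- representative of the tail (head) orbit.  Chaining such realisations, every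
-- configuration of quotient edges in (N1)–(N3) lifts to a configuration of
-- edges of G through common vertices; the axiom holds there, and its
-- conclusion projects back to the quotient.

open import Defs
open import Data.Nat using (ℕ)
open import Data.Fin using (Fin)
open import Data.Fin.Permutation using (Permutation′; _⟨$⟩ʳ_; id; flip; _∘ₚ_; inverseˡ)
open import Data.Bool using (Bool)
open import Data.Product using (∃-syntax; _×_; _,_; proj₁; proj₂)
open import Data.Sum using (_⊎_; inj₁; inj₂)
open import Relation.Binary.PropositionalEquality using (_≡_; _≢_; refl; sym; trans)
open import Relation.Binary.Structures using (IsEquivalence)
open import Relation.Nullary using (¬_)

module _ {n : ℕ} {E : Fin n → Fin n → Set} {col : Fin n → Bool} {Γ : Permutation′ n → Set}
         (Γ≤AutI : IsSubgroupAutI E col Γ) where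

  open IsSubgroupAutI Γ≤AutI

  private
    _~_ : Fin n → Fin n → Set
    _~_ = SameOrbit Γ

    Q : Fin n → Fin n → Set
    Q = QuotEdge E Γ

  orbit-refl : ∀ {x} → x ~ x
  orbit-refl = id , has-id , refl

  orbit-sym : ∀ {x y} → x ~ y → y ~ x
  orbit-sym (π , π∈Γ , refl) = flip π , inv-closed π π∈Γ , inverseˡ π

  orbit-trans : ∀ {x y z} → x ~ y → y ~ z → x ~ z
  orbit-trans (π , π∈Γ , refl) (ρ , ρ∈Γ , refl) = π ∘ₚ ρ , ∘-closed π ρ π∈Γ ρ∈Γ , refl

  orbit-isEquivalence : IsEquivalence _~_
  orbit-isEquivalence = record { refl = orbit-refl ; sym = orbit-sym ; trans = orbit-trans }

  col-orbit : ∀ {x y} → x ~ y → col x ≡ col y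
  col-orbit (π , π∈Γ , refl) = sym (proj₂ (⊆AutI π π∈Γ) _)

  out-edge-transport : ∀ {x y z} → x ~ y → E x z → ∃[ z′ ] (z ~ z′ × E y z′)
  out-edge-transport {z = z} (π , π∈Γ , refl) e =
    π ⟨$⟩ʳ z , (π , π∈Γ , refl) , proj₁ (⊆AutI π π∈Γ) _ z e

  in-edge-transport : ∀ {x y z} → x ~ y → E z x → ∃[ z′ ] (z ~ z′ × E z′ y)
  in-edge-transport {z = z} (π , π∈Γ , refl) e =
    π ⟨$⟩ʳ z , (π , π∈Γ , refl) , proj₁ (⊆AutI π π∈Γ) z _ e

  QuotEdge-from-tail : ∀ {u v u′} → Q u v → u ~ u′ → ∃[ v′ ] (v ~ v′ × E u′ v′)
  QuotEdge-from-tail (_ , _ , u~u₁ , v~v₁ , e) u~u′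
    with out-edge-transport (orbit-trans (orbit-sym u~u₁) u~u′) e
  ... | v′ , v₁~v′ , e′ = v′ , orbit-trans v~v₁ v₁~v′ , e′

  QuotEdge-to-head : ∀ {u v v′} → Q u v → v ~ v′ → ∃[ u′ ] (u ~ u′ × E u′ v′)
  QuotEdge-to-head (_ , _ , u~u₁ , v~v₁ , e) v~v′
    with in-edge-transport (orbit-trans (orbit-sym v~v₁) v~v′) e
  ... | u′ , u₁~u′ , e′ = u′ , orbit-trans u~u₁ u₁~u′ , e′

  QuotEdge-resp : ∀ {x x′ y y′} → x ~ x′ → y ~ y′ → Q x y → Q x′ y′
  QuotEdge-resp x~x′ y~y′ (x₁ , y₁ , x~x₁ , y~y₁ , e) =
    x₁ , y₁ , orbit-trans (orbit-sym x~x′) x~x₁ , orbit-trans (orbit-sym y~y′) y~y₁ , e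

  QuotEdge-bipartite : (∀ {x y} → E x y → col x ≢ col y) → ∀ {x y} → Q x y → col x ≢ col y
  QuotEdge-bipartite bip (_ , _ , x~x₁ , y~y₁ , e) colx≡coly =
    bip e (trans (sym (col-orbit x~x₁)) (trans colx≡coly (col-orbit y~y₁)))

  Independent-lift : ∀ {u v a b} → Independent Q u v → u ~ a → v ~ b → Independent E a b
  Independent-lift (¬Quv , ¬Qvu) u~a v~b =
    (λ e → ¬Quv (_ , _ , u~a , v~b , e)) , (λ e → ¬Qvu (_ , _ , v~b , u~a , e))

  OutSub-project : ∀ {u v a b} → OutSub E a b → u ~ a → v ~ b → OutSub Q u v
  OutSub-project a⊆b u~a v~b y Quy with QuotEdge-from-tail Quy u~a
  ... | y′ , y~y′ , e = _ , y′ , v~b , y~y′ , a⊆b y′ e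

  module _ (G : Is2qBMGFin n E col) where

    open Is2qBMG G using (bipartite; N1; N2; N3)

    QuotEdge-N1 : ∀ u v → Independent Q u v → ¬ (∃[ w ] ∃[ t ] (Q u t × Q v w × Q t w))
    QuotEdge-N1 u v indep (w , t , (u₁ , t₁ , u~u₁ , t~t₁ , e₁) , Qvw , Qtw)
      with QuotEdge-from-tail Qtw t~t₁
    ... | w₂ , w~w₂ , e₂ with QuotEdge-to-head Qvw w~w₂
    ... | v₃ , v~v₃ , e₃ = N1 u₁ v₃ (Independent-lift indep u~u₁ v~v₃) (w₂ , t₁ , e₁ , e₃ , e₂)

    QuotEdge-N2 : ∀ u v w t → Q u v → Q v w → Q w t → Q u t
    QuotEdge-N2 u v w t (u₁ , v₁ , u~u₁ , v~v₁ , e₁) Qvw Qwt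
      with QuotEdge-from-tail Qvw v~v₁
    ... | w₂ , w~w₂ , e₂ with QuotEdge-from-tail Qwt w~w₂
    ... | t₃ , t~t₃ , e₃ = u₁ , t₃ , u~u₁ , t~t₃ , N2 _ _ _ _ e₁ e₂ e₃

    QuotEdge-N3 : ∀ u v → ∃[ x ] (Q u x × Q v x) → OutSub Q u v ⊎ OutSub Q v u
    QuotEdge-N3 u v (x , (u₁ , x₁ , u~u₁ , x~x₁ , e₁) , Qvx)
      with QuotEdge-to-head Qvx x~x₁
    ... | v₂ , v~v₂ , e₂ with N3 u₁ v₂ (x₁ , e₁ , e₂)
    ... | inj₁ u₁⊆v₂ = inj₁ (OutSub-project u₁⊆v₂ u~u₁ v~v₂)
    ... | inj₂ v₂⊆u₁ = inj₂ (OutSub-project v₂⊆u₁ v~v₂ u~u₁)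

theorem3p1 : (n : ℕ) (E : Fin n → Fin n → Set) (col : Fin n → Bool)
    → Is2qBMGFin n E col
    → (Γ : Permutation′ n → Set) → IsSubgroupAutI E col Γ
    → Is2qBMG (SameOrbit Γ) (QuotEdge E Γ) col
theorem3p1 n E col G Γ Γ≤AutI = record
  { ≈-isEquivalence = orbit-isEquivalence Γ≤AutI
  ; E-resp = QuotEdge-resp Γ≤AutI
  ; col-resp = col-orbit Γ≤AutI
  ; loopless = λ x~y Qxy → QuotEdge-bipartite Γ≤AutI bipartite Qxy (col-orbit Γ≤AutI x~y)
  ; bipartite = QuotEdge-bipartite Γ≤AutI bipartite
  ; N1 = QuotEdge-N1 Γ≤AutI G
  ; N2 = QuotEdge-N2 Γ≤AutI G
  ; N3 = QuotEdge-N3 Γ≤AutI G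
  }
  where open Is2qBMG G using (bipartite)
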